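{- Let $m\geq 2$ be an integer. The graph $K_4\times K_m$ is isomorphic to a Cayley graph over a dihedral group if and only if $m$ is not divisible by $4$.
   Context: $K_n$ denotes the complete graph on $n$ vertices and $\Gamma_1\times\Gamma_2$ the Cartesian product of graphs: vertex set $V_1\times V_2$, with $(v_1,v_2)$ adjacent to $(u_1,u_2)$ iff ($v_1=u_1$ and $v_2\sim u_2$) or ($v_2=u_2$ and $v_1\sim u_1$). Dihedral groups are the groups $D_{2n}=\langle x,y:x^n=y^2=e, yxy=x^{ -1}\rangle$ of order $2n$ with $n\geq 3$. A Cayley graph $\mathrm{Cay}(G,S)$ has vertex set $G$ and edges $\{g,sg\}$, $s\in S$. -}

module Defs where

open import Data.Nat using (ℕ; zero; suc; _+_; _∸_)
open import Data.Nat.DivMod using (_mod_)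
open import Data.Bool using (Bool; true; false; _xor_; if_then_else_)
open import Data.Fin using (Fin; toℕ)
open import Data.Product using (_×_; _,_; Σ; ∃)
open import Data.Sum using (_⊎_)
open import Relation.Binary.PropositionalEquality using (_≡_; _≢_)
open import Function.Bundles using (_↔_; Inverse)

record Graph : Set₁ where
  field
    V   : Set
    Adj : V → V → Set

open Graph public

K : ℕ → Graph
K n = record { V = Fin n ; Adj = λ i j → i ≢ j }

_□_ : Graph → Graph → Graph
Γ₁ □ Γ₂ = record
  { V   = V Γ₁ × V Γ₂
  ; Adj = λ { (v₁ , v₂) (u₁ , u₂) →
              (v₁ ≡ u₁ × Adj Γ₂ v₂ u₂) ⊎ (v₂ ≡ u₂ × Adj Γ₁ v₁ u₁) }
  }

record _≅_ (Γ₁ Γ₂ : Graph) : Set where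
  field
    bij      : V Γ₁ ↔ V Γ₂
    preserve : ∀ u v → Adj Γ₁ u v → Adj Γ₂ (Inverse.to bij u) (Inverse.to bij v)
    reflect  : ∀ u v → Adj Γ₂ (Inverse.to bij u) (Inverse.to bij v) → Adj Γ₁ u v

-- Dihedral group D_{2n} = ⟨x, y : x^n = y^2 = e, yxy = x^{-1}⟩, concretely:
-- the element (a , i) stands for x^i y^a (a = false means y^0, a = true means y^1).
Dih : ℕ → Set
Dih n = Bool × Fin n

-- Group multiplication: x^i y^a · x^j y^b = x^(i + (-1)^a j) y^(a+b).
_·_ : ∀ {n} → Dih n → Dih n → Dih n
_·_ {zero}  (a , ()) _
_·_ {suc k} (a , i) (b , j) =
  (a xor b , (toℕ i + (if a then (suc k ∸ toℕ j) else toℕ j)) mod (suc k))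

Cay : (n : ℕ) → (Dih n → Bool) → Graph
Cay n S = record
  { V   = Dih n
  ; Adj = λ g h → Σ (Dih n) λ s → S s ≡ true × ((h ≡ s · g) ⊎ (g ≡ s · h))
  }

IsoToDihedralCayley : Graph → Set
IsoToDihedralCayley Γ =
  Σ ℕ λ n → (3 Data.Nat.≤ n) × Σ (Dih n → Bool) λ S → Γ ≅ Cay n S

{-# OPTIONS --safe #-}
-- K 4 □ K m has 4m vertices, so the group is D_{4m}, whose central involution is z = x^m.
-- Right multiplications are automorphisms of the Cayley graph, and an automorphism of
-- K p □ K q either maps rows to rows and columns to columns or swaps the two families. The
-- dihedral relations rule out swapping, so the row and the column through e are subgroups, of
-- orders m and 4. A subgroup of order divisible by 4 contains z: inversion on it fixes only e,
-- z and the reflections, and left multiplication by a reflection swaps rotations and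
-- reflections. Hence if 4 ∣ m, z lies on both lines through e, which meet only in e.
-- Conversely, if 4 ∤ m write 2m = a b with lcm a b = 2m, taking a = m, b = 2 for odd m and
-- a = 4, b = m / 2 otherwise. Then H = {x^i y^ε : a ∣ i} and the normal subgroup
-- N = {x^i : b ∣ i} are complementary, and Cay(D_{4m}, (H ∪ N) ∖ {e}) ≅ K (2b) □ K a.
module Submission where

open import Defs
open import Algebra.Bundles using (Group)
import Algebra.Properties.Group as GroupProperties
open import Data.Bool using (Bool; true; false; not; T; _∨_; _xor_; if_then_else_)
import Data.Bool.Properties as Bool
import Data.Fin.Properties as Fin
open import Data.Empty using (⊥; ⊥-elim)
open import Data.Fin using (Fin; toℕ; fromℕ<; punchOut) renaming (zero to fzero; suc to fsuc)
open import Data.Fin.Permutation using (permutation; ↔⇒≡)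
open import Data.Fin.Properties
  using (_≟_; _<?_; any?; toℕ-fromℕ<; toℕ-injective; toℕ<n; punchOut-injective; injective⇒≤; *↔×; 2↔Bool)
open import Data.Nat using (ℕ; zero; suc; _+_; _*_; _∸_; _^_; _≤_; _<_; z≤n; s≤s; z<s; _%_; NonZero)
open import Data.Nat.Coprimality using (Coprime; coprime-divisor)
open import Data.Nat.DivMod using (_mod_; %-distribˡ-+; m%n%n≡m%n; n%n≡0; [m+n]%n≡m%n; m<n⇒m%n≡m; m%n≤n)
open import Data.Nat.Divisibility
  using (_∣_; _∣?_; divides; ∣-refl; ∣-trans; ∣1⇒≡1; 0∣⇒≡0; ∣⇒≤; >⇒∤; m%n≡0⇒n∣m; %-presˡ-∣; ∣m+n∣m⇒∣n; ∣m∣n⇒∣m+n;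
         n∣m*n; m∣m*n; *-cancelˡ-∣; *-monoˡ-∣; *-monoʳ-∣)
open import Data.Nat.Properties
  using (+-assoc; +-comm; +-identityʳ; +-suc; +-cancelˡ-≡; *-assoc; *-comm; *-cancelˡ-≡; *-cancelʳ-≡; m+[n∸m]≡n; m∸n+n≡m;
         m+n≡0⇒m≡0; 1+n≢0; <-irrefl; <-cmp; <⇒≤; <⇒≱; <-≤-trans; ≤-trans; n≤1+n; m<m+n; m≤m+n; m≤m*n; 1+n≰n;
         +-mono-<; +-monoʳ-≤; *-monoˡ-<; +-0-commutativeMonoid; +-commutativeSemigroup)
open import Algebra.Properties.CommutativeSemigroup +-commutativeSemigroup using () renaming (interchange to +-interchange)
open import Algebra.Properties.CommutativeMonoid.Sum +-0-commutativeMonoid using (sum; sum-cong-≗; sum-permute; ∑-distrib-+)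
open import Data.Product using (_×_; _,_; proj₁; proj₂; Σ; ∃; swap)
open import Data.Product.Function.NonDependent.Propositional using (_×-↔_)
open import Data.Product.Properties using (≡-dec)
open import Data.Sum using (_⊎_; inj₁; inj₂)
import Data.Sum as Sum
open import Function using (_∘_)
open import Function.Bundles using (_↔_; _⇔_; mk⇔; mk↔ₛ′; Inverse; Equivalence)
open import Function.Properties.Inverse using (↔-trans; ↔-sym; ↔-refl)
open import Function.Related.TypeIsomorphisms using (×-comm)
open import Level using (0ℓ)
open import Relation.Binary.Bundles using (Setoid)
open import Relation.Binary.Definitions using (tri<; tri≈; tri>)
open import Relation.Binary.PropositionalEquality
open import Relation.Binary.PropositionalEquality.Algebra using (isMagma)
import Relation.Binary.Reasoning.Setoid as SetoidReasoning
open import Relation.Nullary using (¬_; Dec; yes; no)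
open import Relation.Nullary.Decidable using (does; does-⇔; dec-true; dec-false; T?; _⊎-dec_; _×-dec_; ¬?)

2∣n+n : ∀ n → 2 ∣ n + n
2∣n+n n = divides n (trans (cong (n +_) (sym (+-identityʳ n))) (*-comm 2 n))

odd-not-even : ∀ n → ¬ 2 ∣ suc (n + n)
odd-not-even n 2∣odd with ∣1⇒≡1 (∣m+n∣m⇒∣n (subst (2 ∣_) (+-comm 1 (n + n)) 2∣odd) (2∣n+n n))
... | ()

multiple-below-double : ∀ {d s} → d ∣ s → s < d + d → s ≡ 0 ⊎ s ≡ d
multiple-below-double (divides zero refl)            _    = inj₁ refl
multiple-below-double (divides (suc zero) refl)      _    = inj₂ (+-identityʳ _)
multiple-below-double {d} (divides (suc (suc q)) refl) s<2d =
  ⊥-elim (<-irrefl refl (<-≤-trans s<2d (+-monoʳ-≤ d (m≤m+n d (q * d)))))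

+-double-injective : ∀ {a b} → a + a ≡ b + b → a ≡ b
+-double-injective {a} {b} eq with <-cmp a b
... | tri< a<b _ _ = ⊥-elim (<-irrefl eq (+-mono-< a<b a<b))
... | tri≈ _ a≡b _ = a≡b
... | tri> _ _ b<a = ⊥-elim (<-irrefl (sym eq) (+-mono-< b<a b<a))

half<double : ∀ {k} h → suc k ≡ h + h → h < suc k
half<double (suc h) eq = subst (suc h <_) (sym eq) (m<m+n (suc h) z<s)

2∣4 : 2 ∣ 4
2∣4 = divides 2 refl

4∤odd : ∀ L → ¬ 4 ∣ suc (L + L)
4∤odd L 4∣odd = odd-not-even L (∣-trans 2∣4 4∣odd)

4∤twice-odd : ∀ L → ¬ 4 ∣ suc (L + L) + suc (L + L)
4∤twice-odd L 4∣2c = odd-not-even L (*-cancelˡ-∣ 2 (subst (2 * 2 ∣_) (n+n≡2*n (suc (L + L))) 4∣2c))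
  where
  n+n≡2*n : ∀ n → n + n ≡ 2 * n
  n+n≡2*n n = cong (n +_) (sym (+-identityʳ n))

odd⇒coprime-2 : ∀ {d} → ¬ 2 ∣ d → Coprime d 2
odd⇒coprime-2 {d} 2∤d {zero}                (_ , 0∣2) with 0∣⇒≡0 0∣2
... | ()
odd⇒coprime-2 {d} 2∤d {suc zero}            _         = refl
odd⇒coprime-2 {d} 2∤d {suc (suc zero)}      (2∣d , _) = ⊥-elim (2∤d 2∣d)
odd⇒coprime-2 {d} 2∤d {suc (suc (suc c))}   (_ , c∣2) with ∣⇒≤ c∣2
... | s≤s (s≤s ())

odd∣2^r*⇒∣ : ∀ {d} r {q} → ¬ 2 ∣ d → d ∣ 2 ^ r * q → d ∣ q
odd∣2^r*⇒∣ {d} zero    {q} _   d∣q = subst (d ∣_) (+-identityʳ q) d∣q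
odd∣2^r*⇒∣ {d} (suc r) {q} 2∤d d∣  =
  odd∣2^r*⇒∣ r 2∤d (coprime-divisor (odd⇒coprime-2 2∤d) (subst (d ∣_) (*-assoc 2 (2 ^ r) q) d∣))

odd-lcm : ∀ {d i} r → ¬ 2 ∣ d → d ∣ i → 2 ^ r ∣ i → d * 2 ^ r ∣ i
odd-lcm {d} r 2∤d d∣i (divides q refl) = *-monoˡ-∣ (2 ^ r) (odd∣2^r*⇒∣ r 2∤d (subst (d ∣_) (*-comm q (2 ^ r)) d∣i))

multiple-below⇒≡0 : ∀ {d i} → d ∣ i → i < d → i ≡ 0
multiple-below⇒≡0 {i = zero}  _   _   = refl
multiple-below⇒≡0 {i = suc i} d∣i i<d = ⊥-elim (<⇒≱ i<d (∣⇒≤ d∣i))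

xor-not-not : ∀ a b → not a xor not b ≡ a xor b
xor-not-not false b = Bool.not-involutive b
xor-not-not true  b = refl

xor-cong-⇔ : ∀ {a b c d} → (a ≡ b ⇔ c ≡ d) → a xor c ≡ b xor d
xor-cong-⇔ {a} {b} {c} {d} a≡b⇔c≡d with a Bool.≟ b | c Bool.≟ d
... | yes refl | _       = cong (a xor_) (Equivalence.to a≡b⇔c≡d refl)
... | no a≢b   | yes c≡d = ⊥-elim (a≢b (Equivalence.from a≡b⇔c≡d c≡d))
... | no a≢b   | no c≢d  rewrite Bool.¬-not a≢b | Bool.¬-not c≢d = xor-not-not b d

xor-≡⇒ : ∀ a b {t} → a xor b ≡ t → a ≡ t xor b
xor-≡⇒ false false refl = refl
xor-≡⇒ false true  refl = refl
xor-≡⇒ true  false refl = refl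
xor-≡⇒ true  true  refl = refl

does-true⇒ : ∀ {A : Set} (a? : Dec A) → does a? ≡ true → A
does-true⇒ (yes a) _ = a

↔-to-injective : ∀ {A B : Set} (f : A ↔ B) {x y} → Inverse.to f x ≡ Inverse.to f y → x ≡ y
↔-to-injective f {x} {y} eq = trans (sym (Inverse.strictlyInverseʳ f x)) (trans (cong (Inverse.from f) eq) (Inverse.strictlyInverseʳ f y))

fin-injective⇒surjective : ∀ {n} (f : Fin n → Fin n) → (∀ {x y} → f x ≡ f y → x ≡ y) → ∀ y → ∃ λ x → f x ≡ y
fin-injective⇒surjective {suc n} f f-injective y with any? (λ x → f x ≟ y)
... | yes found = found
... | no  missed = ⊥-elim (1+n≰n (injective⇒≤ {f = f′} f′-injective))
  where
  f≢y : ∀ x → y ≢ f x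
  f≢y x y≡fx = missed (x , sym y≡fx)
  f′ : Fin (suc n) → Fin n
  f′ x = punchOut (f≢y x)
  f′-injective : ∀ {x x′} → f′ x ≡ f′ x′ → x ≡ x′
  f′-injective eq = f-injective (punchOut-injective (f≢y _) (f≢y _) eq)

injective⇒surjective : ∀ {A B : Set} {n} → A ↔ Fin n → B ↔ Fin n → (f : A → B) →
                       (∀ {x y} → f x ≡ f y → x ≡ y) → ∀ y → ∃ λ x → f x ≡ y
injective⇒surjective A↔n B↔n f f-injective y
  with fin-injective⇒surjective f′ (↔-to-injective (↔-sym A↔n) ∘ f-injective ∘ ↔-to-injective B↔n) (Inverse.to B↔n y)
  where
  f′ : Fin _ → Fin _
  f′ = Inverse.to B↔n ∘ f ∘ Inverse.from A↔n
... | x , f′x≡y = Inverse.from A↔n x , ↔-to-injective B↔n f′x≡y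

two-others : ∀ {a} (i : Fin (3 + a)) → Σ (Fin (3 + a) × Fin (3 + a)) λ (j , j′) → j ≢ i × j′ ≢ i × j ≢ j′
two-others fzero               = (fsuc fzero , fsuc (fsuc fzero)) , (λ ()) , (λ ()) , (λ ())
two-others (fsuc fzero)        = (fzero , fsuc (fsuc fzero)) , (λ ()) , (λ ()) , (λ ())
two-others (fsuc (fsuc i))     = (fzero , fsuc fzero) , (λ ()) , (λ ()) , (λ ())

indicator : Bool → ℕ
indicator b = if b then 1 else 0

indicator-∨ : ∀ a b → (T a → b ≡ false) → indicator (a ∨ b) ≡ indicator a + indicator b
indicator-∨ false b _ = refl
indicator-∨ true  b a⇒¬b rewrite a⇒¬b _ = refl

count : ∀ {M} → (Fin M → Bool) → ℕ
count P = sum (indicator ∘ P)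

count-cong : ∀ {M} {P Q : Fin M → Bool} → (∀ i → P i ≡ Q i) → count P ≡ count Q
count-cong P≗Q = sum-cong-≗ (cong indicator ∘ P≗Q)

count-involution : ∀ {M} (P : Fin M → Bool) (ι : Fin M → Fin M) → (∀ i → ι (ι i) ≡ i) →
                   count (P ∘ ι) ≡ count P
count-involution P ι ι-involutive = sym (sum-permute (indicator ∘ P) (permutation ι ι ι-involutive ι-involutive))

count-+ : ∀ {M} (P Q R : Fin M → Bool) → (∀ i → indicator (R i) ≡ indicator (P i) + indicator (Q i)) →
          count R ≡ count P + count Q
count-+ P Q R split = trans (sum-cong-≗ split) (∑-distrib-+ (indicator ∘ P) (indicator ∘ Q))

count-complement : ∀ {M} (P : Fin M → Bool) → count P + count (not ∘ P) ≡ M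
count-complement {zero}  P = refl
count-complement {suc M} P with P fzero
... | true  = cong suc (count-complement (P ∘ fsuc))
... | false = trans (+-suc (count (P ∘ fsuc)) _) (cong suc (count-complement (P ∘ fsuc)))

count-none : ∀ {M} (P : Fin M → Bool) → (∀ i → P i ≡ false) → count P ≡ 0
count-none {zero}  P none = refl
count-none {suc M} P none rewrite none fzero = count-none (P ∘ fsuc) (none ∘ fsuc)

count-≟ : ∀ {M} (i₀ : Fin M) → count (λ i → does (i ≟ i₀)) ≡ 1
count-≟ {suc M} fzero     = cong suc (count-none {M} (λ i → does (fsuc i ≟ fzero)) (λ i → refl))
count-≟ {suc M} (fsuc i₀) = count-≟ i₀

-- An involution of Fin M pairs off its non-fixed points; counting each pair at its larger
-- element gives M = #fixed points + 2 L.
involution-parity : ∀ {M} (ι : Fin M → Fin M) → (∀ i → ι (ι i) ≡ i) →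
                    let L = count (λ i → does (ι i <? i)) in
                    M ≡ count (λ i → does (i ≟ ι i)) + (L + L)
involution-parity {M} ι ι-involutive = trans (sym (count-complement fixed)) (cong (count fixed +_) nonfixed)
  where
  fixed below above : Fin M → Bool
  fixed i = does (i ≟ ι i)
  below i = does (ι i <? i)
  above i = does (i <? ι i)
  trichotomy : ∀ i → indicator (not (does (i ≟ ι i))) ≡ indicator (does (ι i <? i)) + indicator (does (i <? ι i))
  trichotomy i with Fin.<-cmp i (ι i)
  ... | tri< i<ιi i≢ιi ιi≮i
    rewrite dec-false (i ≟ ι i) i≢ιi | dec-false (ι i <? i) ιi≮i | dec-true (i <? ι i) i<ιi = refl
  ... | tri≈ i≮ιi i≡ιi ιi≮i
    rewrite dec-true (i ≟ ι i) i≡ιi | dec-false (ι i <? i) ιi≮i | dec-false (i <? ι i) i≮ιi = refl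
  ... | tri> i≮ιi i≢ιi ιi<i
    rewrite dec-false (i ≟ ι i) i≢ιi | dec-true (ι i <? i) ιi<i | dec-false (i <? ι i) i≮ιi = refl
  nonfixed : count (not ∘ fixed) ≡ count below + count below
  nonfixed = trans (count-+ below above (not ∘ fixed) trichotomy)
                   (cong (count below +_) (trans (count-cong (λ i → cong (λ j → does (j <? ι i)) (sym (ι-involutive i))))
                                                 (count-involution below ι ι-involutive)))

□-comm : ∀ {Γ₁ Γ₂} → (Γ₁ □ Γ₂) ≅ (Γ₂ □ Γ₁)
□-comm = record
  { bij      = mk↔ₛ′ swap swap (λ _ → refl) (λ _ → refl)
  ; preserve = λ _ _ → Sum.swap
  ; reflect  = λ _ _ → Sum.swap
  }

≅-trans : ∀ {Γ₁ Γ₂ Γ₃} → Γ₁ ≅ Γ₂ → Γ₂ ≅ Γ₃ → Γ₁ ≅ Γ₃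
≅-trans I J = record
  { bij      = ↔-trans (_≅_.bij I) (_≅_.bij J)
  ; preserve = λ u v → _≅_.preserve J _ _ ∘ _≅_.preserve I u v
  ; reflect  = λ u v → _≅_.reflect I u v ∘ _≅_.reflect J _ _
  }

vertex-count : ∀ {p q k} {S : Dih (suc k) → Bool} → (K p □ K q) ≅ Cay (suc k) S → p * q ≡ 2 * suc k
vertex-count I = ↔⇒≡ (↔-trans *↔× (↔-trans (_≅_.bij I) (↔-sym (↔-trans *↔× (2↔Bool ×-↔ ↔-refl)))))

module Dihedral (k : ℕ) where

  n : ℕ
  n = suc k

  D : Set
  D = Dih n

  -- A record rather than a synonym for x % n ≡ y % n, so that x and y can be inferred.
  infix 4 _≡ₙ_
  record _≡ₙ_ (x y : ℕ) : Set where
    constructor mod-≡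
    field %-≡ : x % n ≡ y % n

  ≡ₙ-setoid : Setoid 0ℓ 0ℓ
  ≡ₙ-setoid = record
    { Carrier = ℕ
    ; _≈_ = _≡ₙ_
    ; isEquivalence = record
      { refl = mod-≡ refl
      ; sym = λ (mod-≡ p) → mod-≡ (sym p)
      ; trans = λ (mod-≡ p) (mod-≡ q) → mod-≡ (trans p q)
      }
    }

  module ≡ₙ-Reasoning = SetoidReasoning ≡ₙ-setoid
  open Setoid ≡ₙ-setoid public using () renaming (refl to ≡ₙ-refl; sym to ≡ₙ-sym; trans to ≡ₙ-trans)

  ≡⇒≡ₙ : ∀ {x y} → x ≡ y → x ≡ₙ y
  ≡⇒≡ₙ refl = ≡ₙ-refl

  %-≡ₙ : ∀ x → x % n ≡ₙ x
  %-≡ₙ x = mod-≡ (m%n%n≡m%n x n)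

  n≡ₙ0 : n ≡ₙ 0
  n≡ₙ0 = mod-≡ (n%n≡0 n)

  +-congₙ : ∀ {x x′ y y′} → x ≡ₙ x′ → y ≡ₙ y′ → x + y ≡ₙ x′ + y′
  +-congₙ {x} {x′} {y} {y′} (mod-≡ p) (mod-≡ q) = mod-≡ (begin
    (x + y) % n             ≡⟨ %-distribˡ-+ x y n ⟩
    (x % n + y % n) % n     ≡⟨ cong₂ (λ a b → (a + b) % n) p q ⟩
    (x′ % n + y′ % n) % n   ≡⟨ %-distribˡ-+ x′ y′ n ⟨
    (x′ + y′) % n           ∎)
    where open ≡-Reasoning

  +-cancelʳₙ : ∀ {x y} z → x + z ≡ₙ y + z → x ≡ₙ y
  +-cancelʳₙ {x} {y} z eq = begin
    x                       ≈⟨ ≡⇒≡ₙ (+-identityʳ x) ⟨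
    x + 0                   ≈⟨ +-congₙ ≡ₙ-refl z+z̄≡ₙ0 ⟨
    x + (z + z̄)             ≡⟨ +-assoc x z z̄ ⟨
    x + z + z̄               ≈⟨ +-congₙ eq ≡ₙ-refl ⟩
    y + z + z̄               ≡⟨ +-assoc y z z̄ ⟩
    y + (z + z̄)             ≈⟨ +-congₙ ≡ₙ-refl z+z̄≡ₙ0 ⟩
    y + 0                   ≡⟨ +-identityʳ y ⟩
    y                       ∎
    where
    open ≡ₙ-Reasoning
    z̄ : ℕ
    z̄ = n ∸ z % n
    z+z̄≡ₙ0 : z + z̄ ≡ₙ 0
    z+z̄≡ₙ0 = begin
      z + z̄                 ≈⟨ +-congₙ (%-≡ₙ z) ≡ₙ-refl ⟨
      z % n + z̄             ≡⟨ m+[n∸m]≡n (m%n≤n z n) ⟩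
      n                     ≈⟨ n≡ₙ0 ⟩
      0                     ∎

  -- n ∸ x stands for −x modulo n.
  signed : Bool → ℕ → ℕ
  signed a x = if a then n ∸ x else x

  signed-not+signed : ∀ a {x} → x ≤ n → signed (not a) x + signed a x ≡ₙ 0
  signed-not+signed false x≤n = ≡ₙ-trans (≡⇒≡ₙ (m∸n+n≡m x≤n)) n≡ₙ0
  signed-not+signed true  x≤n = ≡ₙ-trans (≡⇒≡ₙ (m+[n∸m]≡n x≤n)) n≡ₙ0

  signed-+-% : ∀ a b {x y} → x ≤ n → y ≤ n →
               signed a ((x + signed b y) % n) ≡ₙ signed a x + signed (a xor b) y
  signed-+-% false b {x} {y} _ _ = %-≡ₙ (x + signed b y)
  signed-+-% true  b {x} {y} x≤n y≤n = +-cancelʳₙ w (≡ₙ-trans lhs+w≡ₙ0 (≡ₙ-sym rhs+w≡ₙ0))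
    where
    open ≡ₙ-Reasoning
    w : ℕ
    w = x + signed b y
    lhs+w≡ₙ0 : n ∸ w % n + w ≡ₙ 0
    lhs+w≡ₙ0 = begin
      n ∸ w % n + w       ≈⟨ +-congₙ ≡ₙ-refl (%-≡ₙ w) ⟨
      n ∸ w % n + w % n   ≡⟨ m∸n+n≡m (m%n≤n w n) ⟩
      n                   ≈⟨ n≡ₙ0 ⟩
      0                   ∎
    rhs+w≡ₙ0 : (n ∸ x + signed (not b) y) + w ≡ₙ 0
    rhs+w≡ₙ0 = begin
      (n ∸ x + signed (not b) y) + (x + signed b y)  ≡⟨ +-interchange (n ∸ x) (signed (not b) y) x (signed b y) ⟩
      (n ∸ x + x) + (signed (not b) y + signed b y)  ≈⟨ +-congₙ (≡⇒≡ₙ (m∸n+n≡m x≤n)) (signed-not+signed b y≤n) ⟩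
      n + 0                                          ≈⟨ +-congₙ n≡ₙ0 ≡ₙ-refl ⟩
      0                                              ∎

  reflection? : D → Bool
  reflection? = proj₁

  exponent : D → ℕ
  exponent g = toℕ (proj₂ g)

  exponent≤n : ∀ g → exponent g ≤ n
  exponent≤n g = <⇒≤ (toℕ<n (proj₂ g))

  D-≡ : ∀ {g h : D} → reflection? g ≡ reflection? h → exponent g ≡ₙ exponent h → g ≡ h
  D-≡ {a , i} {.a , j} refl (mod-≡ eq) = cong (a ,_) (toℕ-injective (begin
    toℕ i           ≡⟨ m<n⇒m%n≡m (toℕ<n i) ⟨
    toℕ i % n       ≡⟨ eq ⟩
    toℕ j % n       ≡⟨ m<n⇒m%n≡m (toℕ<n j) ⟩
    toℕ j           ∎))
    where open ≡-Reasoning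

  _∙_ : D → D → D
  _∙_ = _·_

  infixl 7 _∙_

  exponent-∙-% : ∀ g h → exponent (g ∙ h) ≡ (exponent g + signed (reflection? g) (exponent h)) % n
  exponent-∙-% (a , i) (b , j) = toℕ-fromℕ< _

  exponent-∙ : ∀ g h → exponent (g ∙ h) ≡ₙ exponent g + signed (reflection? g) (exponent h)
  exponent-∙ g h = ≡ₙ-trans (≡⇒≡ₙ (exponent-∙-% g h)) (%-≡ₙ _)

  ∙-assoc : ∀ g h l → (g ∙ h) ∙ l ≡ g ∙ (h ∙ l)
  ∙-assoc g@(a , _) h@(b , _) l = D-≡ (Bool.xor-assoc a b (reflection? l)) (begin
    exponent ((g ∙ h) ∙ l)                                          ≈⟨ exponent-∙ (g ∙ h) l ⟩
    exponent (g ∙ h) + signed (a xor b) (exponent l)                ≈⟨ +-congₙ (exponent-∙ g h) ≡ₙ-refl ⟩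
    exponent g + signed a (exponent h) + signed (a xor b) (exponent l)
                                                                    ≡⟨ +-assoc (exponent g) _ _ ⟩
    exponent g + (signed a (exponent h) + signed (a xor b) (exponent l))
                                                                    ≈⟨ +-congₙ ≡ₙ-refl (signed-+-% a b (exponent≤n h) (exponent≤n l)) ⟨
    exponent g + signed a ((exponent h + signed b (exponent l)) % n) ≡⟨ cong (λ t → exponent g + signed a t) (exponent-∙-% h l) ⟨
    exponent g + signed a (exponent (h ∙ l))                        ≈⟨ exponent-∙ g (h ∙ l) ⟨
    exponent (g ∙ (h ∙ l))                                          ∎)
    where open ≡ₙ-Reasoning

  e : D
  e = (false , fzero)

  ∙-identityˡ : ∀ g → e ∙ g ≡ g
  ∙-identityˡ g = D-≡ refl (exponent-∙ e g)

  ∙-identityʳ : ∀ g → g ∙ e ≡ g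
  ∙-identityʳ g@(a , _) = D-≡ (Bool.xor-identityʳ a) (≡ₙ-trans (exponent-∙ g e) (signed-0 a))
    where
    signed-0 : ∀ a → exponent g + signed a 0 ≡ₙ exponent g
    signed-0 false = ≡⇒≡ₙ (+-identityʳ (exponent g))
    signed-0 true  = mod-≡ ([m+n]%n≡m%n (exponent g) n)

  inv : D → D
  inv (false , i) = (false , (n ∸ toℕ i) mod n)
  inv (true  , i) = (true , i)

  exponent-inv : ∀ g → exponent (inv g) ≡ₙ signed (not (reflection? g)) (exponent g)
  exponent-inv (false , i) = ≡ₙ-trans (≡⇒≡ₙ (toℕ-fromℕ< _)) (%-≡ₙ _)
  exponent-inv (true  , i) = ≡ₙ-refl

  reflection?-inv : ∀ g → reflection? (inv g) ≡ reflection? g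
  reflection?-inv (false , _) = refl
  reflection?-inv (true  , _) = refl

  exponent-inv∙ : ∀ g → exponent (inv g ∙ g) ≡ₙ 0
  exponent-inv∙ g@(a , _) = begin
    exponent (inv g ∙ g)                                   ≈⟨ exponent-∙ (inv g) g ⟩
    exponent (inv g) + signed (reflection? (inv g)) (exponent g)
                                                           ≡⟨ cong (λ b → exponent (inv g) + signed b (exponent g)) (reflection?-inv g) ⟩
    exponent (inv g) + signed a (exponent g)               ≈⟨ +-congₙ (exponent-inv g) ≡ₙ-refl ⟩
    signed (not a) (exponent g) + signed a (exponent g)    ≈⟨ signed-not+signed a (exponent≤n g) ⟩
    0                                                      ∎
    where open ≡ₙ-Reasoning

  ∙-inverseˡ : ∀ g → inv g ∙ g ≡ e
  ∙-inverseˡ g@(false , _) = D-≡ refl (exponent-inv∙ g)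
  ∙-inverseˡ g@(true  , _) = D-≡ refl (exponent-inv∙ g)

  ∙-inverseʳ : ∀ g → g ∙ inv g ≡ e
  ∙-inverseʳ g@(false , i) = D-≡ refl (begin
    exponent (g ∙ inv g)                ≈⟨ exponent-∙ g (inv g) ⟩
    exponent g + exponent (inv g)       ≈⟨ +-congₙ ≡ₙ-refl (exponent-inv g) ⟩
    exponent g + (n ∸ exponent g)       ≡⟨ m+[n∸m]≡n (exponent≤n g) ⟩
    n                                   ≈⟨ n≡ₙ0 ⟩
    0                                   ∎)
    where open ≡ₙ-Reasoning
  ∙-inverseʳ g@(true , _) = ∙-inverseˡ g

  dihedral : Group 0ℓ 0ℓ
  dihedral = record
    { Carrier = D
    ; _≈_ = _≡_
    ; _∙_ = _∙_
    ; ε = e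
    ; _⁻¹ = inv
    ; isGroup = record
      { isMonoid = record
        { isSemigroup = record { isMagma = isMagma _∙_ ; assoc = ∙-assoc }
        ; identity = ∙-identityˡ , ∙-identityʳ
        }
      ; inverse = ∙-inverseˡ , ∙-inverseʳ
      ; ⁻¹-cong = cong inv
      }
    }

  open GroupProperties dihedral public

  rotations-commute : ∀ i j → (false , i) ∙ (false , j) ≡ (false , j) ∙ (false , i)
  rotations-commute i j = D-≡ refl (begin
    exponent ((false , i) ∙ (false , j))   ≈⟨ exponent-∙ (false , i) (false , j) ⟩
    toℕ i + toℕ j                         ≡⟨ +-comm (toℕ i) (toℕ j) ⟩
    toℕ j + toℕ i                         ≈⟨ exponent-∙ (false , j) (false , i) ⟨
    exponent ((false , j) ∙ (false , i))   ∎)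
    where open ≡ₙ-Reasoning

  reflection-inverts : ∀ i j → (true , i) ∙ (false , j) ≡ inv (false , j) ∙ (true , i)
  reflection-inverts i j = D-≡ refl (begin
    exponent ((true , i) ∙ (false , j))          ≈⟨ exponent-∙ (true , i) (false , j) ⟩
    toℕ i + (n ∸ toℕ j)                         ≡⟨ +-comm (toℕ i) _ ⟩
    (n ∸ toℕ j) + toℕ i                         ≈⟨ +-congₙ (exponent-inv (false , j)) ≡ₙ-refl ⟨
    exponent (inv (false , j)) + toℕ i           ≈⟨ exponent-∙ (inv (false , j)) (true , i) ⟨
    exponent (inv (false , j) ∙ (true , i))      ∎)
    where open ≡ₙ-Reasoning

  inv-reflection : ∀ {g} → T (reflection? g) → inv g ≡ g
  inv-reflection {true , _} _ = refl

  Cay-∙ʳ : ∀ {S} c {g h} → Adj (Cay n S) g h → Adj (Cay n S) (g ∙ c) (h ∙ c)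
  Cay-∙ʳ c {g} {h} (s , s∈S , inj₁ h≡s∙g) = s , s∈S , inj₁ (trans (cong (_∙ c) h≡s∙g) (∙-assoc s g c))
  Cay-∙ʳ c {g} {h} (s , s∈S , inj₂ g≡s∙h) = s , s∈S , inj₂ (trans (cong (_∙ c) g≡s∙h) (∙-assoc s h c))

  quotient-common-left : ∀ a b c → (a ∙ b) ∙ inv (a ∙ c) ≡ a ∙ (b ∙ inv c) ∙ inv a
  quotient-common-left a b c = begin
    (a ∙ b) ∙ inv (a ∙ c)        ≡⟨ cong ((a ∙ b) ∙_) (⁻¹-anti-homo-∙ a c) ⟩
    (a ∙ b) ∙ (inv c ∙ inv a)    ≡⟨ ∙-assoc (a ∙ b) (inv c) (inv a) ⟨
    (a ∙ b) ∙ inv c ∙ inv a      ≡⟨ cong (_∙ inv a) (∙-assoc a b (inv c)) ⟩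
    a ∙ (b ∙ inv c) ∙ inv a      ∎
    where open ≡-Reasoning

  quotient-common-right : ∀ a b c → (a ∙ c) ∙ inv (b ∙ c) ≡ a ∙ inv b
  quotient-common-right a b c = begin
    (a ∙ c) ∙ inv (b ∙ c)        ≡⟨ cong ((a ∙ c) ∙_) (⁻¹-anti-homo-∙ b c) ⟩
    (a ∙ c) ∙ (inv c ∙ inv b)    ≡⟨ ∙-assoc (a ∙ c) (inv c) (inv b) ⟨
    (a ∙ c) ∙ inv c ∙ inv b      ≡⟨ cong (_∙ inv b) (//-rightDividesʳ c a) ⟩
    a ∙ inv b                    ∎
    where open ≡-Reasoning

  ∣signed : ∀ {d x} a → d ∣ n → d ∣ x → x ≤ n → d ∣ signed a x
  ∣signed false _   d∣x _   = d∣x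
  ∣signed {d} {x} true d∣n d∣x x≤n = ∣m+n∣m⇒∣n (subst (d ∣_) (sym (m+[n∸m]≡n x≤n)) d∣n) d∣x

  ∣exponent-∙ : ∀ {d g h} → d ∣ n → d ∣ exponent g → d ∣ exponent h → d ∣ exponent (g ∙ h)
  ∣exponent-∙ {d} {g} {h} d∣n d∣g d∣h = subst (d ∣_) (sym (exponent-∙-% g h))
    (%-presˡ-∣ (∣m∣n⇒∣m+n d∣g (∣signed (reflection? g) d∣n d∣h (exponent≤n h))) d∣n)

  ∣exponent-inv : ∀ {d g} → d ∣ n → d ∣ exponent g → d ∣ exponent (inv g)
  ∣exponent-inv {d} {false , i} d∣n d∣g = subst (d ∣_) (sym (toℕ-fromℕ< _)) (%-presˡ-∣ (∣signed true d∣n d∣g (exponent≤n (false , i))) d∣n)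
  ∣exponent-inv {d} {true  , i} d∣n d∣g = d∣g

  conjugate-rotation : ∀ c i → c ∙ (false , i) ∙ inv c ≡ (false , i) ⊎ c ∙ (false , i) ∙ inv c ≡ inv (false , i)
  conjugate-rotation c@(false , j) i = inj₁ (trans (cong (_∙ inv c) (rotations-commute j i)) (//-rightDividesʳ c (false , i)))
  conjugate-rotation c@(true  , j) i = inj₂ (trans (cong (_∙ inv c) (reflection-inverts j i)) (//-rightDividesʳ c (inv (false , i))))

  infix 4 _≟ᴰ_
  _≟ᴰ_ : (g h : D) → Dec (g ≡ h)
  _≟ᴰ_ = ≡-dec Bool._≟_ _≟_

record EnumeratedSubgroup (k M : ℕ) : Set₁ where
  open Dihedral k
  field
    Member         : D → Set
    ∙-closed       : ∀ {g h} → Member g → Member h → Member (g ∙ h)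
    inv-closed     : ∀ {g} → Member g → Member (inv g)
    e-member       : Member e
    enum           : Fin M → D
    enum-injective : ∀ {i j} → enum i ≡ enum j → i ≡ j
    enum-member    : ∀ i → Member (enum i)
    enum-onto      : ∀ {g} → Member g → Σ (Fin M) λ i → enum i ≡ g

module CentralInvolution (k h : ℕ) (n≡h+h : suc k ≡ h + h) where
  open Dihedral k

  h<n : h < n
  h<n = half<double h n≡h+h

  z : D
  z = false , fromℕ< h<n

  z≢e : z ≢ e
  z≢e z≡e = h≢0 (trans (sym (toℕ-fromℕ< h<n)) (cong exponent z≡e))
    where
    h≢0 : h ≢ 0
    h≢0 h≡0 = 1+n≢0 (trans n≡h+h (cong (λ x → x + x) h≡0))

  rotation-involution : ∀ i → (false , i) ∙ (false , i) ≡ e → (false , i) ≡ e ⊎ (false , i) ≡ z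
  rotation-involution i g²≡e with multiple-below-double n∣i+i (+-mono-< (toℕ<n i) (toℕ<n i))
    where
    n∣i+i : n ∣ toℕ i + toℕ i
    n∣i+i = m%n≡0⇒n∣m _ n (_≡ₙ_.%-≡ (≡ₙ-trans (≡ₙ-sym (exponent-∙ (false , i) (false , i))) (≡⇒≡ₙ (cong exponent g²≡e))))
  ... | inj₁ i+i≡0 = inj₁ (D-≡ refl (≡⇒≡ₙ (m+n≡0⇒m≡0 (toℕ i) i+i≡0)))
  ... | inj₂ i+i≡n = inj₂ (D-≡ refl (≡⇒≡ₙ (trans (+-double-injective {toℕ i} (trans i+i≡n n≡h+h))
                                                 (sym (toℕ-fromℕ< h<n)))))

  self-inverse : ∀ g → g ≢ z → inv g ≡ g → T (reflection? g) ⊎ g ≡ e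
  self-inverse (true  , i) _   _         = inj₁ _
  self-inverse (false , i) g≢z inv-g≡g with rotation-involution i (trans (cong ((false , i) ∙_) (sym inv-g≡g)) (∙-inverseʳ (false , i)))
  ... | inj₁ g≡e = inj₂ g≡e
  ... | inj₂ g≡z = ⊥-elim (g≢z g≡z)

  module _ {M} (H : EnumeratedSubgroup k M) where
    open EnumeratedSubgroup H

    -- Without z, the self-inverse elements of H are e and its reflections, so by
    -- involution-parity M = #reflections + 1 + 2L. If H has a reflection, multiplying by
    -- it swaps rotations and reflections, so #reflections = M / 2; either way 4 ∤ M.
    private module WithoutZ (z∉H : ∀ i → enum i ≢ z) where
      ι : Fin M → Fin M
      ι i = proj₁ (enum-onto (inv-closed (enum-member i)))

      enum-ι : ∀ i → enum (ι i) ≡ inv (enum i)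
      enum-ι i = proj₂ (enum-onto (inv-closed (enum-member i)))

      ι-involutive : ∀ i → ι (ι i) ≡ i
      ι-involutive i = enum-injective (trans (enum-ι (ι i)) (trans (cong inv (enum-ι i)) (⁻¹-involutive (enum i))))

      i₀ : Fin M
      i₀ = proj₁ (enum-onto e-member)

      reflection-in-H : Fin M → Bool
      reflection-in-H i = reflection? (enum i)

      fixed⇔ : ∀ i → (i ≡ ι i) ⇔ (T (reflection-in-H i) ⊎ i ≡ i₀)
      fixed⇔ i = mk⇔ to from
        where
        to : i ≡ ι i → T (reflection-in-H i) ⊎ i ≡ i₀
        to i≡ιi with self-inverse (enum i) (z∉H i) (trans (sym (enum-ι i)) (cong enum (sym i≡ιi)))
        ... | inj₁ refl-i = inj₁ refl-i
        ... | inj₂ enum-i≡e = inj₂ (enum-injective (trans enum-i≡e (sym (proj₂ (enum-onto e-member)))))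
        self-inverse⇒fixed : inv (enum i) ≡ enum i → i ≡ ι i
        self-inverse⇒fixed eq = enum-injective (trans (sym eq) (sym (enum-ι i)))
        from : T (reflection-in-H i) ⊎ i ≡ i₀ → i ≡ ι i
        from (inj₁ refl-i) = self-inverse⇒fixed (inv-reflection refl-i)
        from (inj₂ refl) = self-inverse⇒fixed (trans (cong inv (proj₂ (enum-onto e-member))) (trans ε⁻¹≈ε (sym (proj₂ (enum-onto e-member)))))

      reflection⇒≢i₀ : ∀ i → T (reflection-in-H i) → does (i ≟ i₀) ≡ false
      reflection⇒≢i₀ i refl-i = dec-false (i ≟ i₀) λ { refl → subst (T ∘ reflection?) (proj₂ (enum-onto e-member)) refl-i }

      count-fixed : count (λ i → does (i ≟ ι i)) ≡ count reflection-in-H + 1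
      count-fixed = trans (count-+ reflection-in-H (λ i → does (i ≟ i₀)) (λ i → does (i ≟ ι i)) split)
                          (cong (count reflection-in-H +_) (count-≟ i₀))
        where
        split : ∀ i → indicator (does (i ≟ ι i)) ≡ indicator (reflection-in-H i) + indicator (does (i ≟ i₀))
        split i = trans (cong indicator (does-⇔ (fixed⇔ i) (i ≟ ι i) (T? (reflection-in-H i) ⊎-dec (i ≟ i₀))))
                        (indicator-∨ (reflection-in-H i) _ (reflection⇒≢i₀ i))

      L : ℕ
      L = count (λ i → does (ι i <? i))

      M≡#reflections+1+2L : M ≡ (count reflection-in-H + 1) + (L + L)
      M≡#reflections+1+2L = trans (involution-parity ι ι-involutive) (cong (_+ (L + L)) count-fixed)

      reflections-are-half : ∀ i₁ → T (reflection-in-H i₁) → M ≡ count reflection-in-H + count reflection-in-H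
      reflections-are-half i₁ refl-i₁ = trans (sym (count-complement reflection-in-H))
                                           (cong (count reflection-in-H +_) count-involution-swaps)
        where
        translate : Fin M → Fin M
        translate i = proj₁ (enum-onto (∙-closed (enum-member i₁) (enum-member i)))
        enum-translate : ∀ i → enum (translate i) ≡ enum i₁ ∙ enum i
        enum-translate i = proj₂ (enum-onto (∙-closed (enum-member i₁) (enum-member i)))
        translate-involutive : ∀ i → translate (translate i) ≡ i
        translate-involutive i = enum-injective (begin
          enum (translate (translate i))            ≡⟨ enum-translate (translate i) ⟩
          enum i₁ ∙ enum (translate i)       ≡⟨ cong (enum i₁ ∙_) (enum-translate i) ⟩
          enum i₁ ∙ (enum i₁ ∙ enum i) ≡⟨ cong (_∙ (enum i₁ ∙ enum i)) (inv-reflection refl-i₁) ⟨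
          inv (enum i₁) ∙ (enum i₁ ∙ enum i) ≡⟨ \\-leftDividesʳ (enum i₁) (enum i) ⟩
          enum i                      ∎)
          where open ≡-Reasoning
        translate-flips : ∀ i → reflection-in-H (translate i) ≡ not (reflection-in-H i)
        translate-flips i = trans (cong reflection? (enum-translate i)) (cong (_xor reflection? (enum i)) (Equivalence.to Bool.T-≡ refl-i₁))
        count-involution-swaps : count (not ∘ reflection-in-H) ≡ count reflection-in-H
        count-involution-swaps = trans (sym (count-cong translate-flips)) (count-involution reflection-in-H translate translate-involutive)

      4∤M : ¬ 4 ∣ M
      4∤M 4∣M with any? (λ i → T? (reflection-in-H i))
      ... | no none = 4∤odd L (subst (4 ∣_) (trans M≡#reflections+1+2L (cong (λ c → (c + 1) + (L + L)) no-reflections)) 4∣M)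
        where
        no-reflections : count reflection-in-H ≡ 0
        no-reflections = count-none reflection-in-H (λ i → dec-false (T? (reflection-in-H i)) (λ t → none (i , t)))
      ... | yes (i₁ , refl-i₁) = 4∤twice-odd L (subst (4 ∣_) (trans halves (cong₂ _+_ c≡ c≡)) 4∣M)
        where
        c : ℕ
        c = count reflection-in-H
        halves : M ≡ c + c
        halves = reflections-are-half i₁ refl-i₁
        c≡ : c ≡ suc (L + L)
        c≡ = +-cancelˡ-≡ c c (suc (L + L)) (trans (sym halves) (trans M≡#reflections+1+2L (+-assoc c 1 (L + L))))

    contains-z : 4 ∣ M → Member z
    contains-z 4∣M with any? (λ i → enum i ≟ᴰ z)
    ... | yes (i , enum-i≡z) = subst Member enum-i≡z (enum-member i)
    ... | no z∉H = ⊥-elim (WithoutZ.4∤M (λ i enum-i≡z → z∉H (i , enum-i≡z)) 4∣M)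

module RookGraph (p q : ℕ) where

  Vertex : Set
  Vertex = Fin p × Fin q

  infix 4 _~_
  _~_ : Vertex → Vertex → Set
  _~_ = Adj (K p □ K q)

  ~-sym : ∀ {u v} → u ~ v → v ~ u
  ~-sym (inj₁ (≡₁ , ≢₂)) = inj₁ (sym ≡₁ , ≢₂ ∘ sym)
  ~-sym (inj₂ (≡₂ , ≢₁)) = inj₂ (sym ≡₂ , ≢₁ ∘ sym)

  ~⇒≢ : ∀ {u v} → u ~ v → u ≢ v
  ~⇒≢ (inj₁ (_ , ≢₂)) refl = ≢₂ refl
  ~⇒≢ (inj₂ (_ , ≢₁)) refl = ≢₁ refl

  sameColumn : Vertex → Vertex → Bool
  sameColumn u v = does (proj₂ u ≟ proj₂ v)

  sameColumn-sym : ∀ u v → sameColumn u v ≡ sameColumn v u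
  sameColumn-sym u v with proj₂ u ≟ proj₂ v
  ... | yes u₂≡v₂ = sym (dec-true (proj₂ v ≟ proj₂ u) (sym u₂≡v₂))
  ... | no  u₂≢v₂ = sym (dec-false (proj₂ v ≟ proj₂ u) (u₂≢v₂ ∘ sym))

  column-edge : ∀ {u v} → proj₂ u ≡ proj₂ v → u ≡ v ⊎ (u ~ v × sameColumn u v ≡ true)
  column-edge {u₁ , u₂} {v₁ , v₂} u₂≡v₂ with u₁ ≟ v₁
  ... | yes refl = inj₁ (cong (u₁ ,_) u₂≡v₂)
  ... | no  u₁≢v₁ = inj₂ (inj₂ (u₂≡v₂ , u₁≢v₁) , dec-true (u₂ ≟ v₂) u₂≡v₂)

  row-edge : ∀ {u v} → proj₁ u ≡ proj₁ v → u ≡ v ⊎ (u ~ v × sameColumn u v ≡ false)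
  row-edge {u₁ , u₂} {v₁ , v₂} u₁≡v₁ with u₂ ≟ v₂
  ... | yes refl  = inj₁ (cong (_, u₂) u₁≡v₁)
  ... | no  u₂≢v₂ = inj₂ (inj₁ (u₁≡v₁ , u₂≢v₂) , refl)

  sameColumn⇒≡₂ : ∀ {u v} → sameColumn u v ≡ true → proj₂ u ≡ proj₂ v
  sameColumn⇒≡₂ {u} {v} same with proj₂ u ≟ proj₂ v
  ... | yes u₂≡v₂ = u₂≡v₂

  sameColumn≢⇒≢₂ : ∀ {u v} → sameColumn u v ≡ false → proj₂ u ≢ proj₂ v
  sameColumn≢⇒≢₂ {u} {v} different u₂≡v₂ with proj₂ u ≟ proj₂ v
  ... | no u₂≢v₂ = u₂≢v₂ u₂≡v₂

  ~⇒≡₁ : ∀ {u v} → u ~ v → proj₂ u ≢ proj₂ v → proj₁ u ≡ proj₁ v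
  ~⇒≡₁ (inj₁ (u₁≡v₁ , _)) _     = u₁≡v₁
  ~⇒≡₁ (inj₂ (u₂≡v₂ , _)) u₂≢v₂ = ⊥-elim (u₂≢v₂ u₂≡v₂)

  ~⇒≢₁ : ∀ {u v} → u ~ v → proj₂ u ≡ proj₂ v → proj₁ u ≢ proj₁ v
  ~⇒≢₁ (inj₁ (_ , u₂≢v₂)) u₂≡v₂ = ⊥-elim (u₂≢v₂ u₂≡v₂)
  ~⇒≢₁ (inj₂ (_ , u₁≢v₁)) _     = u₁≢v₁

  sameColumn-≡⇔~ : ∀ {u v w} → u ~ v → u ~ w → v ≢ w → (sameColumn u v ≡ sameColumn u w ⇔ v ~ w)
  sameColumn-≡⇔~ {u} {v} {w} uv uw v≢w with proj₂ u ≟ proj₂ v | proj₂ u ≟ proj₂ w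
  ... | yes u₂≡v₂ | yes u₂≡w₂ = mk⇔ (λ _ → inj₂ (v₂≡w₂ , λ v₁≡w₁ → v≢w (cong₂ _,_ v₁≡w₁ v₂≡w₂))) (λ _ → refl)
    where
    v₂≡w₂ : proj₂ v ≡ proj₂ w
    v₂≡w₂ = trans (sym u₂≡v₂) u₂≡w₂
  ... | no u₂≢v₂  | no u₂≢w₂  = mk⇔ (λ _ → inj₁ (v₁≡w₁ , λ v₂≡w₂ → v≢w (cong₂ _,_ v₁≡w₁ v₂≡w₂))) (λ _ → refl)
    where
    v₁≡w₁ : proj₁ v ≡ proj₁ w
    v₁≡w₁ = trans (sym (~⇒≡₁ uv u₂≢v₂)) (~⇒≡₁ uw u₂≢w₂)
  ... | yes u₂≡v₂ | no u₂≢w₂  = mk⇔ (λ ()) (⊥-elim ∘ λ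
    { (inj₁ (v₁≡w₁ , _)) → ~⇒≢₁ uv u₂≡v₂ (trans (~⇒≡₁ uw u₂≢w₂) (sym v₁≡w₁))
    ; (inj₂ (v₂≡w₂ , _)) → u₂≢w₂ (trans u₂≡v₂ v₂≡w₂) })
  ... | no u₂≢v₂  | yes u₂≡w₂ = mk⇔ (λ ()) (⊥-elim ∘ λ
    { (inj₁ (v₁≡w₁ , _)) → ~⇒≢₁ uw u₂≡w₂ (trans (~⇒≡₁ uv u₂≢v₂) v₁≡w₁)
    ; (inj₂ (v₂≡w₂ , _)) → u₂≢v₂ (trans u₂≡w₂ (sym v₂≡w₂)) })

  module Automorphism (f : Vertex → Vertex) (f-injective : ∀ {u v} → f u ≡ f v → u ≡ v)
                      (f-~ : ∀ {u v} → u ~ v → f u ~ f v) (f-~⁻¹ : ∀ {u v} → f u ~ f v → u ~ v) where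

    PreservesLines SwapsLines : Set
    PreservesLines = (∀ {u v} → proj₁ u ≡ proj₁ v → proj₁ (f u) ≡ proj₁ (f v))
                   × (∀ {u v} → proj₂ u ≡ proj₂ v → proj₂ (f u) ≡ proj₂ (f v))
    SwapsLines     = (∀ {u v} → proj₁ u ≡ proj₁ v → proj₂ (f u) ≡ proj₂ (f v))
                   × (∀ {u v} → proj₂ u ≡ proj₂ v → proj₁ (f u) ≡ proj₁ (f v))

    -- Whether f turns the edge uv from a row into a column or back. By the triangle criterion
    -- sameColumn-≡⇔~ it agrees on any two edges at a vertex, so it is constant.
    flips : Vertex → Vertex → Bool
    flips u v = sameColumn (f u) (f v) xor sameColumn u v

    flips-sym : ∀ u v → flips u v ≡ flips v u
    flips-sym u v = cong₂ _xor_ (sameColumn-sym (f u) (f v)) (sameColumn-sym u v)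

    flips-local : ∀ {u v w} → u ~ v → u ~ w → v ≢ w → flips u v ≡ flips u w
    flips-local {u} {v} {w} uv uw v≢w = xor-cong-⇔ (mk⇔
      (λ eq → Equivalence.from below (f-~⁻¹ (Equivalence.to above eq)))
      (λ eq → Equivalence.from above (f-~ (Equivalence.to below eq))))
      where
      below : sameColumn u v ≡ sameColumn u w ⇔ v ~ w
      below = sameColumn-≡⇔~ uv uw v≢w
      above : sameColumn (f u) (f v) ≡ sameColumn (f u) (f w) ⇔ f v ~ f w
      above = sameColumn-≡⇔~ (f-~ uv) (f-~ uw) (v≢w ∘ f-injective)

    module _ (other : Fin p → Fin p) (other-≢ : ∀ i → other i ≢ i) where

      neighbour : Vertex → Vertex
      neighbour (i , j) = other i , j

      ~-neighbour : ∀ u → u ~ neighbour u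
      ~-neighbour (i , j) = inj₂ (refl , other-≢ i ∘ sym)

      flipsAt : Vertex → Bool
      flipsAt u = flips u (neighbour u)

      flips≡flipsAt : ∀ {u v} → u ~ v → flips u v ≡ flipsAt u
      flips≡flipsAt {u} {v} uv with ≡-dec _≟_ _≟_ v (neighbour u)
      ... | yes refl = refl
      ... | no  v≢n  = flips-local uv (~-neighbour u) v≢n

      flipsAt-~ : ∀ {u v} → u ~ v → flipsAt u ≡ flipsAt v
      flipsAt-~ {u} {v} uv = trans (sym (flips≡flipsAt uv)) (trans (flips-sym u v) (flips≡flipsAt (~-sym uv)))

      flipsAt-line : ∀ {A : Set} {u v} → u ≡ v ⊎ (u ~ v × A) → flipsAt u ≡ flipsAt v
      flipsAt-line (inj₁ refl)     = refl
      flipsAt-line (inj₂ (uv , _)) = flipsAt-~ uv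

      flipsAt-constant : ∀ u v → flipsAt u ≡ flipsAt v
      flipsAt-constant (u₁ , u₂) (v₁ , v₂) = trans (flipsAt-line (row-edge {u₁ , u₂} {u₁ , v₂} refl))
                                                   (flipsAt-line (column-edge {u₁ , v₂} {v₁ , v₂} refl))

      flips-constant : ∀ {u v} x₀ → u ~ v → flips u v ≡ flipsAt x₀
      flips-constant {u} x₀ uv = trans (flips≡flipsAt uv) (flipsAt-constant u x₀)

      image-sameColumn : ∀ {u v} x₀ → u ~ v → sameColumn (f u) (f v) ≡ flipsAt x₀ xor sameColumn u v
      image-sameColumn {u} {v} x₀ uv = xor-≡⇒ (sameColumn (f u) (f v)) (sameColumn u v) (flips-constant x₀ uv)

      image-in-row : ∀ {u v} x₀ → u ~ v → flipsAt x₀ xor sameColumn u v ≡ false → proj₁ (f u) ≡ proj₁ (f v)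
      image-in-row {u} {v} x₀ uv t≡false = ~⇒≡₁ (f-~ uv) (sameColumn≢⇒≢₂ {f u} {f v} (trans (image-sameColumn x₀ uv) t≡false))

      image-in-column : ∀ {u v} x₀ → u ~ v → flipsAt x₀ xor sameColumn u v ≡ true → proj₂ (f u) ≡ proj₂ (f v)
      image-in-column {u} {v} x₀ uv t≡true = sameColumn⇒≡₂ {f u} {f v} (trans (image-sameColumn x₀ uv) t≡true)

      preserves-or-swaps : Vertex → PreservesLines ⊎ SwapsLines
      preserves-or-swaps x₀ with flipsAt x₀ in flipsAt≡
      ... | false = inj₁ (row↦row , column↦column)
        where
        row↦row : ∀ {u v} → proj₁ u ≡ proj₁ v → proj₁ (f u) ≡ proj₁ (f v)
        row↦row {u} {v} u₁≡v₁ with row-edge {u} {v} u₁≡v₁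
        ... | inj₁ refl          = refl
        ... | inj₂ (uv , s≡false) = image-in-row x₀ uv (cong₂ _xor_ flipsAt≡ s≡false)
        column↦column : ∀ {u v} → proj₂ u ≡ proj₂ v → proj₂ (f u) ≡ proj₂ (f v)
        column↦column {u} {v} u₂≡v₂ with column-edge {u} {v} u₂≡v₂
        ... | inj₁ refl          = refl
        ... | inj₂ (uv , s≡true) = image-in-column x₀ uv (cong₂ _xor_ flipsAt≡ s≡true)
      ... | true = inj₂ (row↦column , column↦row)
        where
        row↦column : ∀ {u v} → proj₁ u ≡ proj₁ v → proj₂ (f u) ≡ proj₂ (f v)
        row↦column {u} {v} u₁≡v₁ with row-edge {u} {v} u₁≡v₁
        ... | inj₁ refl          = refl
        ... | inj₂ (uv , s≡false) = image-in-column x₀ uv (cong₂ _xor_ flipsAt≡ s≡false)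
        column↦row : ∀ {u v} → proj₂ u ≡ proj₂ v → proj₁ (f u) ≡ proj₁ (f v)
        column↦row {u} {v} u₂≡v₂ with column-edge {u} {v} u₂≡v₂
        ... | inj₁ refl          = refl
        ... | inj₂ (uv , s≡true) = image-in-row x₀ uv (cong₂ _xor_ flipsAt≡ s≡true)

module Grid (k : ℕ) {p′ q′ : ℕ} (grid : Dih (suc k) ↔ (Fin (3 + p′) × Fin (3 + q′))) where
  open Dihedral k
  open Inverse grid public using (to; from; strictlyInverseˡ; strictlyInverseʳ)

  π₁ : D → Fin (3 + p′)
  π₁ = proj₁ ∘ to

  π₂ : D → Fin (3 + q′)
  π₂ = proj₂ ∘ to

  grid-≡ : ∀ {g h} → π₁ g ≡ π₁ h → π₂ g ≡ π₂ h → g ≡ h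
  grid-≡ ≡₁ ≡₂ = ↔-to-injective grid (cong₂ _,_ ≡₁ ≡₂)

  infix 4 _↦_
  _↦_ : ∀ {A B : Set} → (D → A) → (D → B) → D → Set
  (πa ↦ πb) c = ∀ {g h} → πa g ≡ πa h → πb (g ∙ c) ≡ πb (h ∙ c)

  ↦-e : ∀ {A} (π : D → A) → (π ↦ π) e
  ↦-e π {g} {h} eq = trans (cong π (∙-identityʳ g)) (trans eq (sym (cong π (∙-identityʳ h))))

  ↦-∙ : ∀ {A B C} (πa : D → A) (πb : D → B) (πc : D → C) {c d} →
        (πa ↦ πb) c → (πb ↦ πc) d → (πa ↦ πc) (c ∙ d)
  ↦-∙ _ _ πc {c} {d} ab bc {g} {h} eq =
    trans (cong πc (sym (∙-assoc g c d))) (trans (bc {g ∙ c} {h ∙ c} (ab {g} {h} eq)) (cong πc (∙-assoc h c d)))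

  Preserving Swapping : D → Set
  Preserving c = (π₁ ↦ π₁) c × (π₂ ↦ π₂) c
  Swapping   c = (π₁ ↦ π₂) c × (π₂ ↦ π₁) c

  preserving-e : Preserving e
  preserving-e = ↦-e π₁ , ↦-e π₂

  preserving-∙ : ∀ {c d} → Preserving c → Preserving d → Preserving (c ∙ d)
  preserving-∙ (c₁ , c₂) (d₁ , d₂) = ↦-∙ π₁ π₁ π₁ c₁ d₁ , ↦-∙ π₂ π₂ π₂ c₂ d₂

  swapping-∙-swapping : ∀ {c d} → Swapping c → Swapping d → Preserving (c ∙ d)
  swapping-∙-swapping (c₁ , c₂) (d₁ , d₂) = ↦-∙ π₁ π₂ π₁ c₁ d₂ , ↦-∙ π₂ π₁ π₂ c₂ d₁

  swapping-∙-preserving : ∀ {c d} → Swapping c → Preserving d → Swapping (c ∙ d)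
  swapping-∙-preserving (c₁ , c₂) (d₁ , d₂) = ↦-∙ π₁ π₂ π₂ c₁ d₂ , ↦-∙ π₂ π₁ π₁ c₂ d₁

  -- Two distinct points of a π₁-line would be sent to one point.
  ¬preserving×swapping : ∀ {c} → Preserving c → Swapping c → ⊥
  ¬preserving×swapping {c} (c₁ , _) (c₁₂ , _) = u≢v (∙-cancelʳ c u v (grid-≡ (c₁ refl₁) (c₁₂ refl₁)))
    where
    u v : D
    u = from (fzero , fzero)
    v = from (fzero , fsuc fzero)
    refl₁ : π₁ u ≡ π₁ v
    refl₁ = trans (cong proj₁ (strictlyInverseˡ _)) (sym (cong proj₁ (strictlyInverseˡ _)))
    u≢v : u ≢ v
    u≢v u≡v with ↔-to-injective (↔-sym grid) u≡v
    ... | ()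

  ↦-from-e : ∀ {A B} (πa : D → A) (πb : D → B) x {y} → (πa ↦ πb) y → πa x ≡ πa e → πb (x ∙ y) ≡ πb y
  ↦-from-e _ πb x {y} ab x∈ = trans (ab {x} {e} x∈) (cong πb (∙-identityˡ y))

  Line₁ Line₂ : D → Set
  Line₁ g = π₁ g ≡ π₁ e
  Line₂ g = π₂ g ≡ π₂ e

  line₁-subgroup : (∀ c → Preserving c) → EnumeratedSubgroup k (3 + q′)
  line₁-subgroup preserving = record
    { Member         = Line₁
    ; ∙-closed       = λ {g} {h} g∈ h∈ → trans (↦-from-e π₁ π₁ g (proj₁ (preserving h)) g∈) h∈
    ; inv-closed     = λ {g} g∈ → trans (sym (↦-from-e π₁ π₁ g (proj₁ (preserving (inv g))) g∈)) (cong π₁ (∙-inverseʳ g))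
    ; e-member       = refl
    ; enum           = λ y → from (π₁ e , y)
    ; enum-injective = λ eq → cong proj₂ (↔-to-injective (↔-sym grid) eq)
    ; enum-member    = λ y → cong proj₁ (strictlyInverseˡ _)
    ; enum-onto      = λ {g} g∈ → π₂ g , trans (cong (λ x → from (x , π₂ g)) (sym g∈)) (strictlyInverseʳ g)
    }

  module WithDichotomy (dichotomy : ∀ c → Preserving c ⊎ Swapping c) where

    swapping-inv : ∀ {c} → Swapping c → Swapping (inv c)
    swapping-inv {c} sw with dichotomy (inv c)
    ... | inj₂ sw⁻¹ = sw⁻¹
    ... | inj₁ pr⁻¹ = ⊥-elim (¬preserving×swapping preserving-e
                               (subst Swapping (∙-inverseʳ c) (swapping-∙-preserving sw pr⁻¹)))

    preserving-inv : ∀ {c} → Preserving c → Preserving (inv c)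
    preserving-inv {c} pr with dichotomy (inv c)
    ... | inj₁ pr⁻¹ = pr⁻¹
    ... | inj₂ sw⁻¹ = ⊥-elim (¬preserving×swapping pr (subst Swapping (⁻¹-involutive c) (swapping-inv sw⁻¹)))

    swapping-on-Line₁⇒inv∈Line₂ : ∀ {c} → Line₁ c → Swapping c → Line₂ (inv c)
    swapping-on-Line₁⇒inv∈Line₂ {c} c∈L₁ sw-c =
      trans (sym (↦-from-e π₁ π₂ c (proj₁ (swapping-inv sw-c)) c∈L₁)) (cong π₂ (∙-inverseʳ c))

    ∙-swapping-on-Line₁ : ∀ {b c} → Line₂ b → Line₁ c → Swapping c → Line₁ (b ∙ c)
    ∙-swapping-on-Line₁ {b} b∈L₂ c∈L₁ sw-c = trans (↦-from-e π₂ π₁ b (proj₂ sw-c) b∈L₂) c∈L₁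

    -- c is a rotation, since a reflection c would lie on both lines through e. If b is a
    -- reflection then b ∙ c = c⁻¹ ∙ b lies on both lines; if b is a rotation it commutes
    -- with c, which moves b onto Line₁.
    swapping-on-Line₁⇒preserving-on-Line₂≡e : ∀ {c b} → Line₁ c → Swapping c → Line₂ b → Preserving b → b ≡ e
    swapping-on-Line₁⇒preserving-on-Line₂≡e {c} {b} c∈L₁ sw-c b∈L₂ pr-b = cases c b refl refl
      where
      inv-c∈L₂ : Line₂ (inv c)
      inv-c∈L₂ = swapping-on-Line₁⇒inv∈Line₂ c∈L₁ sw-c
      b∙c∈L₁ : Line₁ (b ∙ c)
      b∙c∈L₁ = ∙-swapping-on-Line₁ b∈L₂ c∈L₁ sw-c
      cases : ∀ c′ b′ → c′ ≡ c → b′ ≡ b → b ≡ e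
      cases (true , i) _ refl _ with grid-≡ {c} {e} c∈L₁ (trans (cong π₂ (sym (inv-reflection _))) inv-c∈L₂)
      ... | ()
      cases (false , i) (true , j) refl refl with grid-≡ {b ∙ c} {e} b∙c∈L₁ b∙c∈L₂
        where
        b∙c∈L₂ : Line₂ (b ∙ c)
        b∙c∈L₂ = trans (cong π₂ (reflection-inverts j i)) (trans (↦-from-e π₂ π₂ (inv c) (proj₂ pr-b) inv-c∈L₂) b∈L₂)
      ... | b∙c≡e with inverseʳ-unique b c b∙c≡e
      ...   | ()
      cases (false , i) (false , j) refl refl = grid-≡ b∈L₁ b∈L₂
        where
        b∈L₁ : Line₁ b
        b∈L₁ = trans (sym (↦-from-e π₁ π₁ c (proj₁ pr-b) c∈L₁)) (trans (cong π₁ (rotations-commute i j)) b∙c∈L₁)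

transpose : ∀ {k p′ q′} → Dih (suc k) ↔ (Fin (3 + p′) × Fin (3 + q′)) → Dih (suc k) ↔ (Fin (3 + q′) × Fin (3 + p′))
transpose grid = ↔-trans grid (×-comm _ _)

module SwappingOffLine₁ (k : ℕ) {p′ q′} (grid : Dih (suc k) ↔ (Fin (3 + p′) × Fin (3 + q′)))
                        (dichotomy : ∀ c → Grid.Preserving k grid c ⊎ Grid.Swapping k grid c) where
  open Dihedral k
  open Grid k grid

  open WithDichotomy dichotomy
  module Transposed = Grid k (transpose grid)
  open Transposed.WithDichotomy (λ c → Sum.map swap swap (dichotomy c))
    using () renaming (swapping-on-Line₁⇒preserving-on-Line₂≡e to swapping-on-Line₂⇒preserving-on-Line₁≡e)

  -- Line₂ has two points other than e; both swap, so for either of them x the product x ∙ c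
  -- preserves and lies on Line₁, forcing x ∙ c = e (transposed core lemma, applied to c⁻¹).
  ¬swapping-on-Line₁ : ∀ {c} → Line₁ c → ¬ Swapping c
  ¬swapping-on-Line₁ {c} c∈L₁ sw-c with two-others (π₁ e)
  ... | (x , x′) , x≢ , x′≢ , x≢x′ = x≢x′ (trans (sym (π₁-point x)) (trans (cong π₁ point-x≡point-x′) (π₁-point x′)))
    where
    point : Fin (3 + p′) → D
    point y = from (y , π₂ e)
    π₁-point : ∀ y → π₁ (point y) ≡ y
    π₁-point y = cong proj₁ (strictlyInverseˡ _)
    point∈L₂ : ∀ y → Line₂ (point y)
    point∈L₂ y = cong proj₂ (strictlyInverseˡ _)
    point-swaps : ∀ {y} → y ≢ π₁ e → Swapping (point y)
    point-swaps {y} y≢ with dichotomy (point y)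
    ... | inj₂ sw = sw
    ... | inj₁ pr = ⊥-elim (y≢ (trans (sym (π₁-point y))
                      (cong π₁ (swapping-on-Line₁⇒preserving-on-Line₂≡e c∈L₁ sw-c (point∈L₂ y) pr))))
    point∙c≡e : ∀ {y} → y ≢ π₁ e → point y ∙ c ≡ e
    point∙c≡e {y} y≢ = swapping-on-Line₂⇒preserving-on-Line₁≡e
      (swapping-on-Line₁⇒inv∈Line₂ c∈L₁ sw-c) (swap (swapping-inv sw-c))
      (∙-swapping-on-Line₁ (point∈L₂ y) c∈L₁ sw-c) (swap (swapping-∙-swapping (point-swaps y≢) sw-c))
    point-x≡point-x′ : point x ≡ point x′
    point-x≡point-x′ = ∙-cancelʳ c (point x) (point x′) (trans (point∙c≡e x≢) (sym (point∙c≡e x′≢)))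

module NoSwapping (k : ℕ) {p′ q′} (grid : Dih (suc k) ↔ (Fin (3 + p′) × Fin (3 + q′)))
                  (dichotomy : ∀ c → Grid.Preserving k grid c ⊎ Grid.Swapping k grid c) where
  open Dihedral k
  open Grid k grid
  open WithDichotomy dichotomy
  open SwappingOffLine₁ k grid dichotomy using (¬swapping-on-Line₁)
  open SwappingOffLine₁ k (transpose grid) (λ c → Sum.map swap swap (dichotomy c))
    using () renaming (¬swapping-on-Line₁ to ¬swapping-on-Line₂)

  meetLine₁ : D → D
  meetLine₁ c = from (π₁ e , π₂ c)

  meetLine₁∈Line₁ : ∀ c → Line₁ (meetLine₁ c)
  meetLine₁∈Line₁ c = cong proj₁ (strictlyInverseˡ _)

  π₂-meetLine₁ : ∀ c → π₂ (meetLine₁ c) ≡ π₂ c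
  π₂-meetLine₁ c = cong proj₂ (strictlyInverseˡ _)

  -- With w = meetLine₁ c: either w swaps, or w preserves and then c ∙ w⁻¹ swaps and lies on Line₂.
  ¬swapping : ∀ c → ¬ Swapping c
  ¬swapping c sw-c with dichotomy (meetLine₁ c)
  ... | inj₂ sw-w = ¬swapping-on-Line₁ (meetLine₁∈Line₁ c) sw-w
  ... | inj₁ pr-w with dichotomy (c ∙ inv (meetLine₁ c))
  ...   | inj₁ pr = ¬preserving×swapping (subst Preserving (//-rightDividesˡ _ c) (preserving-∙ pr pr-w)) sw-c
  ...   | inj₂ sw = ¬swapping-on-Line₂ c∙w⁻¹∈L₂ (swap sw)
    where
    w : D
    w = meetLine₁ c
    c∙w⁻¹∈L₂ : Line₂ (c ∙ inv w)
    c∙w⁻¹∈L₂ = trans (proj₂ (preserving-inv pr-w) {c} {w} (sym (π₂-meetLine₁ c))) (cong π₂ (∙-inverseʳ w))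

module Forward (m′ k : ℕ) (S : Dih (suc k) → Bool) (I : (K 4 □ K (3 + m′)) ≅ Cay (suc k) S) where
  open Dihedral k
  open RookGraph 4 (3 + m′)

  m : ℕ
  m = 3 + m′

  n≡m+m : n ≡ m + m
  n≡m+m = *-cancelˡ-≡ n (m + m) 2 (begin
    2 * n            ≡⟨ vertex-count I ⟨
    2 * 2 * m        ≡⟨ *-assoc 2 2 m ⟩
    2 * (m + (m + 0)) ≡⟨ cong (λ x → 2 * (m + x)) (+-identityʳ m) ⟩
    2 * (m + m)      ∎)
    where open ≡-Reasoning

  grid : D ↔ Vertex
  grid = ↔-sym (_≅_.bij I)

  open Grid k grid

  ρ : D → Vertex → Vertex
  ρ c u = to (from u ∙ c)

  ρ-to : ∀ c g → ρ c (to g) ≡ to (g ∙ c)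
  ρ-to c g = cong (λ x → to (x ∙ c)) (strictlyInverseʳ g)

  ρ-injective : ∀ c {u v} → ρ c u ≡ ρ c v → u ≡ v
  ρ-injective c {u} {v} eq = ↔-to-injective (↔-sym grid) (∙-cancelʳ c (from u) (from v) (↔-to-injective grid eq))

  to-~ : ∀ {g h} → Adj (Cay n S) g h → to g ~ to h
  to-~ {g} {h} gh = _≅_.reflect I (to g) (to h) (subst₂ (Adj (Cay n S)) (sym (strictlyInverseʳ g)) (sym (strictlyInverseʳ h)) gh)

  from-~ : ∀ {u v} → u ~ v → Adj (Cay n S) (from u) (from v)
  from-~ = _≅_.preserve I _ _

  ρ-~ : ∀ c {u v} → u ~ v → ρ c u ~ ρ c v
  ρ-~ c uv = to-~ (Cay-∙ʳ c (from-~ uv))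

  ρ-~⁻¹ : ∀ c {u v} → ρ c u ~ ρ c v → u ~ v
  ρ-~⁻¹ c {u} {v} ρuv = subst₂ _~_ (strictlyInverseˡ u) (strictlyInverseˡ v)
    (to-~ (subst₂ (Adj (Cay n S)) (//-rightDividesʳ c (from u)) (//-rightDividesʳ c (from v))
      (Cay-∙ʳ (inv c) (subst₂ (Adj (Cay n S)) (strictlyInverseʳ _) (strictlyInverseʳ _) (from-~ ρuv)))))

  other : Fin 4 → Fin 4
  other fzero    = fsuc fzero
  other (fsuc _) = fzero

  other-≢ : ∀ i → other i ≢ i
  other-≢ fzero    ()
  other-≢ (fsuc _) ()

  dichotomy : ∀ c → Preserving c ⊎ Swapping c
  dichotomy c = Sum.map (λ (r , s) → along proj₁ proj₁ r , along proj₂ proj₂ s)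
                        (λ (r , s) → along proj₁ proj₂ r , along proj₂ proj₁ s)
                        (preserves-or-swaps other other-≢ (fzero , fzero))
    where
    open Automorphism (ρ c) (ρ-injective c) (ρ-~ c) (ρ-~⁻¹ c)
    along : ∀ {A B : Set} (πa : Vertex → A) (πb : Vertex → B) →
            (∀ {u v} → πa u ≡ πa v → πb (ρ c u) ≡ πb (ρ c v)) → ((πa ∘ to) ↦ (πb ∘ to)) c
    along πa πb ρ-maps {g} {h} eq = trans (cong πb (sym (ρ-to c g))) (trans (ρ-maps eq) (cong πb (ρ-to c h)))

  preserving : ∀ c → Preserving c
  preserving c with dichotomy c
  ... | inj₁ pr = pr
  ... | inj₂ sw = ⊥-elim (NoSwapping.¬swapping k grid dichotomy c sw)

  -- The lines through e are then subgroups of orders m and 4, and would both contain z.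
  4∤m : ¬ 4 ∣ m
  4∤m 4∣m = z≢e (grid-≡ z∈Line₁ z∈Line₂)
    where
    open CentralInvolution k m n≡m+m
    z∈Line₁ : Line₁ z
    z∈Line₁ = contains-z (line₁-subgroup preserving) 4∣m
    z∈Line₂ : Line₂ z
    z∈Line₂ = contains-z (Grid.line₁-subgroup k (transpose grid) (swap ∘ preserving)) ∣-refl

module _ (k : ℕ) where
  open Dihedral k

  module ComplementCayley
    (H N : D → Set) (H? : ∀ g → Dec (H g)) (N? : ∀ g → Dec (N g))
    (H-∙ : ∀ {g h} → H g → H h → H (g ∙ h)) (H-inv : ∀ {g} → H g → H (inv g))
    (N-∙ : ∀ {g h} → N g → N h → N (g ∙ h)) (N-inv : ∀ {g} → N g → N (inv g))
    (N-normal : ∀ c {g} → N g → N (c ∙ g ∙ inv c)) (H∩N : ∀ {g} → H g → N g → g ≡ e)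
    where

    S? : ∀ g → Dec ((H g ⊎ N g) × g ≢ e)
    S? g = (H? g ⊎-dec N? g) ×-dec ¬? (g ≟ᴰ e)

    S : D → Bool
    S g = does (S? g)

    unique-factorisation : ∀ {a a′ b b′} → H a → H a′ → N b → N b′ → a ∙ b ≡ a′ ∙ b′ → a ≡ a′ × b ≡ b′
    unique-factorisation {a} {a′} {b} {b′} a∈H a′∈H b∈N b′∈N ab≡a′b′ =
      trans (inverseʳ-unique (inv a′) a w≡e) (⁻¹-involutive a′) ,
      sym (x∙y⁻¹≈ε⇒x≈y b′ b (trans (sym w≡b′b⁻¹) w≡e))
      where
      w : D
      w = inv a′ ∙ a
      w≡b′b⁻¹ : w ≡ b′ ∙ inv b
      w≡b′b⁻¹ = begin
        inv a′ ∙ a                        ≡⟨ cong (inv a′ ∙_) (x≈z//y a b (a′ ∙ b′) ab≡a′b′) ⟩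
        inv a′ ∙ ((a′ ∙ b′) ∙ inv b)      ≡⟨ ∙-assoc (inv a′) (a′ ∙ b′) (inv b) ⟨
        (inv a′ ∙ (a′ ∙ b′)) ∙ inv b      ≡⟨ cong (_∙ inv b) (\\-leftDividesʳ a′ b′) ⟩
        b′ ∙ inv b                        ∎
        where open ≡-Reasoning
      w≡e : w ≡ e
      w≡e = H∩N (H-∙ (H-inv a′∈H) a∈H) (subst N (sym w≡b′b⁻¹) (N-∙ b′∈N (N-inv b∈N)))

    S-intro : ∀ {s} → H s ⊎ N s → s ≢ e → S s ≡ true
    S-intro {s} s∈H∪N s≢e = dec-true (S? s) (s∈H∪N , s≢e)

    S-elim : ∀ {s} → S s ≡ true → (H s ⊎ N s) × s ≢ e
    S-elim {s} = does-true⇒ (S? s)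

    -- Rows of the grid are the cosets κ i ∙ N, columns are the cosets H ∙ ν j.
    module _ {p q : ℕ} (κ : Fin p → D) (κ∈H : ∀ i → H (κ i)) (κ-injective : ∀ {i i′} → κ i ≡ κ i′ → i ≡ i′)
                       (ν : Fin q → D) (ν∈N : ∀ j → N (ν j)) (ν-injective : ∀ {j j′} → ν j ≡ ν j′ → j ≡ j′)
                       (p*q≡2n : p * q ≡ 2 * n) where
      open RookGraph p q

      embed : Vertex → D
      embed (i , j) = κ i ∙ ν j

      embed-injective : ∀ {u v} → embed u ≡ embed v → u ≡ v
      embed-injective {i , j} {i′ , j′} eq with unique-factorisation (κ∈H i) (κ∈H i′) (ν∈N j) (ν∈N j′) eq
      ... | κi≡κi′ , νj≡νj′ = cong₂ _,_ (κ-injective κi≡κi′) (ν-injective νj≡νj′)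

      quotient∈H∪N : ∀ {u v} → u ~ v → H (embed v ∙ inv (embed u)) ⊎ N (embed v ∙ inv (embed u))
      quotient∈H∪N {i , j} {.i , j′} (inj₁ (refl , _)) =
        inj₂ (subst N (sym (quotient-common-left (κ i) (ν j′) (ν j))) (N-normal (κ i) (N-∙ (ν∈N j′) (N-inv (ν∈N j)))))
      quotient∈H∪N {i , j} {i′ , .j} (inj₂ (refl , _)) =
        inj₁ (subst H (sym (quotient-common-right (κ i′) (κ i) (ν j))) (H-∙ (κ∈H i′) (H-inv (κ∈H i))))

      embed-~ : ∀ {u v} → u ~ v → Adj (Cay n S) (embed u) (embed v)
      embed-~ {u} {v} uv = embed v ∙ inv (embed u) , S-intro (quotient∈H∪N uv) s≢e , inj₁ (sym (//-rightDividesˡ (embed u) (embed v)))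
        where
        s≢e : embed v ∙ inv (embed u) ≢ e
        s≢e s≡e = ~⇒≢ uv (sym (embed-injective (x∙y⁻¹≈ε⇒x≈y (embed v) (embed u) s≡e)))

      H-multiple⇒~ : ∀ {s u v} → H s → s ≢ e → embed v ≡ s ∙ embed u → u ~ v
      H-multiple⇒~ {s} {i , j} {i′ , j′} s∈H s≢e eq = inj₂ (ν-injective (proj₂ factors) , s≢e ∘ s≡e)
        where
        factors : s ∙ κ i ≡ κ i′ × ν j ≡ ν j′
        factors = unique-factorisation (H-∙ s∈H (κ∈H i)) (κ∈H i′) (ν∈N j) (ν∈N j′) (trans (∙-assoc s (κ i) (ν j)) (sym eq))
        s≡e : i ≡ i′ → s ≡ e
        s≡e refl = ∙-cancelʳ (κ i) s e (trans (proj₁ factors) (sym (∙-identityˡ (κ i))))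

      conj : Fin p → D → D
      conj i s = inv (κ i) ∙ s ∙ κ i

      conj∈N : ∀ i {s} → N s → N (conj i s)
      conj∈N i {s} s∈N = subst (λ x → N (inv (κ i) ∙ s ∙ x)) (⁻¹-involutive (κ i)) (N-normal (inv (κ i)) s∈N)

      κ∙conj : ∀ i s → κ i ∙ conj i s ≡ s ∙ κ i
      κ∙conj i s = trans (sym (∙-assoc (κ i) (inv (κ i) ∙ s) (κ i))) (cong (_∙ κ i) (\\-leftDividesˡ (κ i) s))

      N-multiple⇒~ : ∀ {s u v} → N s → s ≢ e → embed v ≡ s ∙ embed u → u ~ v
      N-multiple⇒~ {s} {i , j} {i′ , j′} s∈N s≢e eq = inj₁ (κ-injective (proj₁ factors) , s≢e ∘ s≡e)
        where
        t : D
        t = conj i s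
        κi∙tνj≡κi′νj′ : κ i ∙ (t ∙ ν j) ≡ κ i′ ∙ ν j′
        κi∙tνj≡κi′νj′ = begin
          κ i ∙ (t ∙ ν j)       ≡⟨ ∙-assoc (κ i) t (ν j) ⟨
          κ i ∙ t ∙ ν j         ≡⟨ cong (_∙ ν j) (κ∙conj i s) ⟩
          s ∙ κ i ∙ ν j         ≡⟨ ∙-assoc s (κ i) (ν j) ⟩
          s ∙ (κ i ∙ ν j)       ≡⟨ eq ⟨
          κ i′ ∙ ν j′           ∎
          where open ≡-Reasoning
        factors : κ i ≡ κ i′ × t ∙ ν j ≡ ν j′
        factors = unique-factorisation (κ∈H i) (κ∈H i′) (N-∙ (conj∈N i s∈N) (ν∈N j)) (ν∈N j′) κi∙tνj≡κi′νj′
        s≡e : j ≡ j′ → s ≡ e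
        s≡e refl = ∙-cancelʳ (κ i) s e (begin
          s ∙ κ i       ≡⟨ κ∙conj i s ⟨
          κ i ∙ t       ≡⟨ cong (κ i ∙_) (∙-cancelʳ (ν j) t e (trans (proj₂ factors) (sym (∙-identityˡ (ν j))))) ⟩
          κ i ∙ e       ≡⟨ ∙-identityʳ (κ i) ⟩
          κ i           ≡⟨ ∙-identityˡ (κ i) ⟨
          e ∙ κ i       ∎)
          where open ≡-Reasoning

      left-multiple⇒~ : ∀ {s u v} → S s ≡ true → embed v ≡ s ∙ embed u → u ~ v
      left-multiple⇒~ s∈S with S-elim s∈S
      ... | inj₁ s∈H , s≢e = H-multiple⇒~ s∈H s≢e
      ... | inj₂ s∈N , s≢e = N-multiple⇒~ s∈N s≢e

      embed-~⁻¹ : ∀ {u v} → Adj (Cay n S) (embed u) (embed v) → u ~ v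
      embed-~⁻¹ (s , s∈S , inj₁ v≡su) = left-multiple⇒~ s∈S v≡su
      embed-~⁻¹ (s , s∈S , inj₂ u≡sv) = ~-sym (left-multiple⇒~ s∈S u≡sv)

      embed-surjective : ∀ g → ∃ λ u → embed u ≡ g
      embed-surjective = injective⇒surjective (↔-sym *↔×) D↔pq embed embed-injective
        where
        D↔pq : D ↔ Fin (p * q)
        D↔pq = subst (λ x → D ↔ Fin x) (sym p*q≡2n) (↔-sym (↔-trans *↔× (2↔Bool ×-↔ ↔-refl)))

      iso : (K p □ K q) ≅ Cay n S
      iso = record
        { bij      = mk↔ₛ′ embed (proj₁ ∘ embed-surjective) (proj₂ ∘ embed-surjective)
                           (λ u → embed-injective (proj₂ (embed-surjective (embed u))))
        ; preserve = λ _ _ → embed-~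
        ; reflect  = λ _ _ → embed-~⁻¹
        }

-- With a = suc a′, b = suc b′ and n = a * b = lcm a b: H = {g : a ∣ exponent g} has order 2b,
-- the normal subgroup N of rotations with b ∣ exponent has order a, and H ∩ N = {e}.
module Factorisation (a′ b′ : ℕ) (lcm : ∀ {i} → suc a′ ∣ i → suc b′ ∣ i → suc a′ * suc b′ ∣ i) where
  a b k : ℕ
  a = suc a′
  b = suc b′
  k = b′ + a′ * b

  open Dihedral k

  H N : D → Set
  H g = a ∣ exponent g
  N g = reflection? g ≡ false × b ∣ exponent g

  a∣n : a ∣ n
  a∣n = m∣m*n b

  b∣n : b ∣ n
  b∣n = n∣m*n a

  H-∙ : ∀ {g h} → H g → H h → H (g ∙ h)
  H-∙ {g} {h} = ∣exponent-∙ {g = g} {h} a∣n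

  H-inv : ∀ {g} → H g → H (inv g)
  H-inv {g} = ∣exponent-inv {g = g} a∣n

  N-∙ : ∀ {g h} → N g → N h → N (g ∙ h)
  N-∙ {g} {h} (g-rot , b∣g) (h-rot , b∣h) = cong₂ _xor_ g-rot h-rot , ∣exponent-∙ {g = g} {h} b∣n b∣g b∣h

  N-inv : ∀ {g} → N g → N (inv g)
  N-inv {g} (g-rot , b∣g) = trans (reflection?-inv g) g-rot , ∣exponent-inv {g = g} b∣n b∣g

  N-normal : ∀ c {g} → N g → N (c ∙ g ∙ inv c)
  N-normal c {false , i} g∈N with conjugate-rotation c i
  ... | inj₁ eq = subst N (sym eq) g∈N
  ... | inj₂ eq = subst N (sym eq) (N-inv g∈N)

  H∩N : ∀ {g} → H g → N g → g ≡ e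
  H∩N {false , i} a∣i (_ , b∣i) = D-≡ refl (≡⇒≡ₙ (multiple-below⇒≡0 (lcm a∣i b∣i) (toℕ<n i)))

  scaled : ∀ r d .{{_ : NonZero d}} → r * d ≡ n → Fin r → Fin n
  scaled r d rd≡n j = fromℕ< (subst (toℕ j * d <_) rd≡n (*-monoˡ-< d (toℕ<n j)))

  scaled-injective : ∀ r d .{{_ : NonZero d}} (rd≡n : r * d ≡ n) {j j′} → scaled r d rd≡n j ≡ scaled r d rd≡n j′ → j ≡ j′
  scaled-injective r d rd≡n {j} {j′} eq =
    toℕ-injective (*-cancelʳ-≡ (toℕ j) (toℕ j′) d (trans (sym (toℕ-fromℕ< _)) (trans (cong toℕ eq) (toℕ-fromℕ< _))))

  ∣scaled : ∀ r d .{{_ : NonZero d}} (rd≡n : r * d ≡ n) j → d ∣ toℕ (scaled r d rd≡n j)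
  ∣scaled r d rd≡n j = subst (d ∣_) (sym (toℕ-fromℕ< _)) (n∣m*n (toℕ j))

  index : Fin (2 * b) ↔ (Bool × Fin b)
  index = ↔-trans *↔× (2↔Bool ×-↔ ↔-refl)

  κ : Fin (2 * b) → D
  κ x = proj₁ (Inverse.to index x) , scaled b a (*-comm b a) (proj₂ (Inverse.to index x))

  κ∈H : ∀ x → H (κ x)
  κ∈H x = ∣scaled b a (*-comm b a) (proj₂ (Inverse.to index x))

  κ-injective : ∀ {x x′} → κ x ≡ κ x′ → x ≡ x′
  κ-injective eq = ↔-to-injective index (cong₂ _,_ (cong proj₁ eq) (scaled-injective b a (*-comm b a) (cong proj₂ eq)))

  ν : Fin a → D
  ν j = false , scaled a b refl j

  ν∈N : ∀ j → N (ν j)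
  ν∈N j = refl , ∣scaled a b refl j

  ν-injective : ∀ {j j′} → ν j ≡ ν j′ → j ≡ j′
  ν-injective eq = scaled-injective a b refl (cong proj₂ eq)

  2b*a≡2n : 2 * b * a ≡ 2 * n
  2b*a≡2n = trans (*-assoc 2 b a) (cong (2 *_) (*-comm b a))

  H? : ∀ g → Dec (H g)
  H? g = a ∣? exponent g

  N? : ∀ g → Dec (N g)
  N? g = (reflection? g Bool.≟ false) ×-dec (b ∣? exponent g)

  module Construction = ComplementCayley k H N H? N? (λ {g} {h} → H-∙ {g} {h}) (λ {g} → H-inv {g})
                           (λ {g} {h} → N-∙ {g} {h}) (λ {g} → N-inv {g}) (λ c {g} → N-normal c {g}) (λ {g} → H∩N {g})

  cayley : (K (2 * b) □ K a) ≅ Cay n Construction.S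
  cayley = Construction.iso κ κ∈H κ-injective ν ν∈N ν-injective 2b*a≡2n

odd-or-twice-odd : ∀ m → ¬ 4 ∣ m → ¬ 2 ∣ m ⊎ Σ ℕ λ t → m ≡ 2 * t × ¬ 2 ∣ t
odd-or-twice-odd m 4∤m with 2 ∣? m
... | no  2∤m              = inj₁ 2∤m
... | yes (divides t m≡t*2) = inj₂ (t , sym 2t≡m , λ 2∣t → 4∤m (subst (4 ∣_) 2t≡m (*-monoʳ-∣ 2 2∣t)))
  where
  2t≡m : 2 * t ≡ m
  2t≡m = sym (trans m≡t*2 (*-comm t 2))

forward : ∀ m → 2 ≤ m → IsoToDihedralCayley (K 4 □ K m) → ¬ 4 ∣ m
forward (suc zero)             (s≤s ())
forward (suc (suc zero))       _ _                          = >⇒∤ (s≤s (s≤s (s≤s z≤n)))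
forward (suc (suc (suc m′)))   _ (zero  , () , _)
forward (suc (suc (suc m′)))   _ (suc k , _  , S , I)       = Forward.4∤m m′ k S I

-- m odd: D_{4m} with a = m, b = 2.
odd-case : ∀ m → 2 ≤ m → ¬ 2 ∣ m → IsoToDihedralCayley (K 4 □ K m)
odd-case (suc zero)      (s≤s ())
odd-case m@(suc (suc x)) _ 2∤m = _ , s≤s (s≤s (s≤s z≤n)) , _ , F.cayley
  where
  module F = Factorisation (suc x) 1 (odd-lcm 1 2∤m)

-- m = 2t with t odd: D_{8t} with a = 4, b = t.
twice-odd-case : ∀ t → 2 ≤ 2 * t → ¬ 2 ∣ t → IsoToDihedralCayley (K 4 □ K (2 * t))
twice-odd-case (suc t′) _ 2∤t = _ , ≤-trans (n≤1+n 3) (m≤m*n 4 (suc t′)) , _ , ≅-trans □-comm F.cayley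
  where
  module F = Factorisation 3 t′ (λ {i} 4∣i t∣i → subst (_∣ i) (*-comm (suc t′) 4) (odd-lcm 2 2∤t t∣i 4∣i))

backward : ∀ m → 2 ≤ m → ¬ 4 ∣ m → IsoToDihedralCayley (K 4 □ K m)
backward m 2≤m 4∤m with odd-or-twice-odd m 4∤m
... | inj₁ 2∤m               = odd-case m 2≤m 2∤m
... | inj₂ (t , refl , 2∤t) = twice-odd-case t 2≤m 2∤t

lemma3p4 : (m : ℕ) → 2 ≤ m → (IsoToDihedralCayley (K 4 □ K m) ⇔ (¬ (4 ∣ m)))
lemma3p4 m 2≤m = mk⇔ (forward m 2≤m) (backward m 2≤m)
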